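{- No deterministic online algorithm can achieve a better competitive ratio than $1.5$ for the online graph embedding problem in the star topology (defined in the context).
   Context: Problem: The host graph is a star on $n$ physical hosts: one distinguished central host is at distance $1$ from every other host, and any two distinct non-central hosts are at distance $2$. A set $X$ of $n$ guest nodes is mapped bijectively to the hosts (a configuration); the guest node mapped to the central host is called the central node. An initial configuration is given. Requests arrive one at a time; each request $\sigma_t=\{x_1,x_2\}$ is a pair of distinct guest nodes, and must be served at a cost equal to the host distance between the hosts of $x_1$ and $x_2$ in the current configuration (cost $1$ if one of them is the central node, $2$ otherwise). At any time an algorithm may migrate a guest node to the center (swap it with the current central node) at cost $1$. The cost of an algorithm is the total serving plus migration cost. An online algorithm decides without knowledge of future requests; an optimal offline algorithm $\mathrm{OPT}$ knows the whole sequence; both start in the same configuration. A deterministic online algorithm is $c$-competitive if $\mathrm{ALG}(\sigma)\le c\cdot\mathrm{OPT}(\sigma)$ for every request sequence $\sigma$. -}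

module Defs where

open import Data.Nat using (ℕ; zero; suc; _+_; _*_; _≤_)
open import Data.Fin using (Fin; _≟_)
open import Data.List using (List; []; _∷_; length; _++_; [_])
open import Data.Bool using (if_then_else_; _∨_)
open import Data.Product using (Σ; ∃; _×_)
open import Relation.Nullary using (does)
open import Relation.Binary.PropositionalEquality using (_≡_; _≢_)

-- Guest nodes are Fin n; hosts: one central host and n-1 leaves.
-- Since all distances in the star depend only on which guest node is central,
-- and the only allowed migration swaps some node with the central node,
-- the relevant state of a configuration is its central node (Fin n).

record Req (n : ℕ) : Set where
  constructor req
  field
    x₁ x₂    : Fin n
    distinct : x₁ ≢ x₂
open Req public

-- Host distance between the hosts of the requested nodes, given central node c.
serveCost : {n : ℕ} → Fin n → Req n → ℕ
serveCost c r = if (does (x₁ r ≟ c) ∨ does (x₂ r ≟ c)) then 1 else 2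

-- Performing a sequence of migrations (each moves the named node to the center,
-- swapping it with the current central node, cost 1 each); returns the new central node.
applyMigs : {n : ℕ} → Fin n → List (Fin n) → Fin n
applyMigs c []       = c
applyMigs c (x ∷ xs) = applyMigs x xs

-- Offline algorithm: for each time step t, the list of migrations performed
-- before serving request t.
Schedule : ℕ → Set
Schedule n = ℕ → List (Fin n)

offCostFrom : {n : ℕ} → Fin n → ℕ → Schedule n → List (Req n) → ℕ
offCostFrom c t s []       = 0
offCostFrom c t s (r ∷ rs) =
  length (s t) + serveCost (applyMigs c (s t)) r
    + offCostFrom (applyMigs c (s t)) (suc t) s rs

offCost : {n : ℕ} → Fin n → Schedule n → List (Req n) → ℕ
offCost c s σ = offCostFrom c 0 s σ

IsOPT : {n : ℕ} → Fin n → List (Req n) → ℕ → Set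
IsOPT {n} c σ k = (Σ (Schedule n) λ s → offCost c s σ ≡ k) × ((s : Schedule n) → k ≤ offCost c s σ)

-- Deterministic online algorithm: given the past requests (chronological order)
-- and the current request, decides the migrations to perform before serving it.
OnlineAlg : ℕ → Set
OnlineAlg n = List (Req n) → Req n → List (Fin n)

onCostFrom : {n : ℕ} → Fin n → OnlineAlg n → List (Req n) → List (Req n) → ℕ
onCostFrom c A hist []       = 0
onCostFrom c A hist (r ∷ rs) =
  length (A hist r) + serveCost (applyMigs c (A hist r)) r
    + onCostFrom (applyMigs c (A hist r)) A (hist ++ [ r ]) rs

onCost : {n : ℕ} → Fin n → OnlineAlg n → List (Req n) → ℕ
onCost c A σ = onCostFrom c A [] σ

Competitive : {n : ℕ} → Fin n → OnlineAlg n → ℕ → ℕ → Set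
Competitive {n} c A p q = (σ : List (Req n)) (k : ℕ) → IsOPT c σ k → q * onCost c A σ ≤ p * k

-- An adversary fixes three nodes 0, 1, 2 and always requests the pair of them
-- that avoids the online algorithm's current central node, so every request
-- costs the algorithm at least 2 (a serve at distance 2, or a migration plus a
-- serve). Against m such requests, the three offline strategies "migrate y to the
-- center once, then stay" (y ∈ {0, 1, 2}) cost 3 + 4m in total, since each
-- request is served at cost 1 + 1 + 2 by them; hence OPT ≤ 1 + 4m/3 while
-- ALG ≥ 2m, and m = 3p + 1 already contradicts q · ALG ≤ p · OPT when 2p < 3q.
module Submission where

open import Defs
open import Data.Nat using (ℕ; zero; suc; _+_; _*_; _≤_; _<_; z≤n; s≤s)
open import Data.Nat.Properties
  using (≤-trans; ≤-reflexive; m≤m+n; n≮n; +-mono-≤; +-monoˡ-≤; *-monoˡ-≤; *-monoʳ-≤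
        ; +-cancelˡ-≤; *-suc; *-assoc; module ≤-Reasoning)
open import Data.Nat.Tactic.RingSolver using (solve-∀)
open import Data.Fin as Fin using (Fin; _≟_; #_)
open import Data.List using (List; []; _∷_; length; _++_; [_]; map; allFin)
open import Data.Nat.ListAction using (sum)
open import Data.List.Extrema.Nat using (argmin; f[argmin]≤f[xs])
open import Data.List.Membership.Propositional.Properties using (∈-allFin)
import Data.List.Relation.Unary.All as All
open import Data.Bool using (true; false; _∨_)
open import Data.Product using (_,_)
open import Relation.Nullary using (¬_; yes; no; does; contradiction)
open import Relation.Binary.PropositionalEquality using (_≡_; refl; sym; cong; cong₂; module ≡-Reasoning)

serveCost≥1 : ∀ {n} (c : Fin n) (r : Req n) → 1 ≤ serveCost c r
serveCost≥1 c r with does (x₁ r ≟ c) ∨ does (x₂ r ≟ c)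
... | true  = s≤s z≤n
... | false = s≤s z≤n

module _ {n : ℕ} where

  moveTo : Fin n → Fin n → List (Fin n)
  moveTo c c' with c' ≟ c
  ... | yes _ = []
  ... | no  _ = [ c' ]

  applyMigs-moveTo : ∀ c c' → applyMigs c (moveTo c c') ≡ c'
  applyMigs-moveTo c c' with c' ≟ c
  ... | yes c'≡c = sym c'≡c
  ... | no  _    = refl

  length-moveTo≤1 : ∀ c c' → length (moveTo c c') ≤ 1
  length-moveTo≤1 c c' with c' ≟ c
  ... | yes _ = z≤n
  ... | no  _ = s≤s z≤n

  length-moveTo-applyMigs : ∀ c ms → length (moveTo c (applyMigs c ms)) ≤ length ms
  length-moveTo-applyMigs c []       with c ≟ c
  ... | yes _   = z≤n
  ... | no  c≢c = contradiction refl c≢c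
  length-moveTo-applyMigs c (m ∷ ms) = ≤-trans (length-moveTo≤1 c (applyMigs m ms)) (s≤s z≤n)

  -- Competitive speaks about the exact optimum, so OPT is computed by a dynamic
  -- programme: only the central node matters, and any migration sequence may be
  -- replaced by at most one migration to the same final center.
  mutual
    opt : Fin n → List (Req n) → ℕ
    opt c []       = 0
    opt c (r ∷ rs) = costVia c r rs (bestNext c r rs)

    costVia : Fin n → Req n → List (Req n) → Fin n → ℕ
    costVia c r rs c' = length (moveTo c c') + serveCost c' r + opt c' rs

    bestNext : Fin n → Req n → List (Req n) → Fin n
    bestNext c r rs = argmin (costVia c r rs) c (allFin n)

  opt≤costVia : ∀ c r rs c' → opt c (r ∷ rs) ≤ costVia c r rs c'
  opt≤costVia c r rs c' = All.lookup (f[argmin]≤f[xs] c (allFin n)) (∈-allFin c')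

  opt≤offCostFrom : ∀ c t s σ → opt c σ ≤ offCostFrom c t s σ
  opt≤offCostFrom c t s []       = z≤n
  opt≤offCostFrom c t s (r ∷ rs) = ≤-trans (opt≤costVia c r rs c')
    (+-mono-≤ (+-monoˡ-≤ (serveCost c' r) (length-moveTo-applyMigs c (s t)))
              (opt≤offCostFrom c' (suc t) s rs))
    where c' = applyMigs c (s t)

  offCostFrom-suc : ∀ c t (s : Schedule n) σ → offCostFrom c (suc t) s σ ≡ offCostFrom c t (λ u → s (suc u)) σ
  offCostFrom-suc c t s []       = refl
  offCostFrom-suc c t s (r ∷ rs) =
    cong (length (s (suc t)) + serveCost c' r +_) (offCostFrom-suc c' (suc t) s rs)
    where c' = applyMigs c (s (suc t))

  _∷ₛ_ : List (Fin n) → Schedule n → Schedule n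
  (ms ∷ₛ s) zero    = ms
  (ms ∷ₛ s) (suc t) = s t

  optSchedule : Fin n → List (Req n) → Schedule n
  optSchedule c []       = λ _ → []
  optSchedule c (r ∷ rs) = moveTo c c' ∷ₛ optSchedule c' rs
    where c' = bestNext c r rs

  offCost-optSchedule : ∀ c σ → offCost c (optSchedule c σ) σ ≡ opt c σ
  offCost-optSchedule c []       = refl
  offCost-optSchedule c (r ∷ rs) = begin
      length (moveTo c c') + serveCost (applyMigs c (moveTo c c')) r
        + offCostFrom (applyMigs c (moveTo c c')) 1 s rs
    ≡⟨ cong (λ d → length (moveTo c c') + serveCost d r + offCostFrom d 1 s rs) (applyMigs-moveTo c c') ⟩
      length (moveTo c c') + serveCost c' r + offCostFrom c' 1 s rs
    ≡⟨ cong (length (moveTo c c') + serveCost c' r +_) (offCostFrom-suc c' 0 s rs) ⟩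
      length (moveTo c c') + serveCost c' r + offCost c' (optSchedule c' rs) rs
    ≡⟨ cong (length (moveTo c c') + serveCost c' r +_) (offCost-optSchedule c' rs) ⟩
      opt c (r ∷ rs)
    ∎
    where
      open ≡-Reasoning
      c' = bestNext c r rs
      s  = optSchedule c (r ∷ rs)

  isOPT-opt : ∀ c σ → IsOPT c σ (opt c σ)
  isOPT-opt c σ = (optSchedule c σ , offCost-optSchedule c σ) , λ s → opt≤offCostFrom c 0 s σ

  staticCost : Fin n → List (Req n) → ℕ
  staticCost y σ = sum (map (serveCost y) σ)

  offCostFrom-stay : ∀ y t σ → offCostFrom y t (λ _ → []) σ ≡ staticCost y σ
  offCostFrom-stay y t []       = refl
  offCostFrom-stay y t (r ∷ rs) = cong (serveCost y r +_) (offCostFrom-stay y (suc t) rs)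

  opt≤1+staticCost : ∀ c y σ → opt c σ ≤ 1 + staticCost y σ
  opt≤1+staticCost c y []       = z≤n
  opt≤1+staticCost c y (r ∷ rs) = begin
      opt c (r ∷ rs)
    ≤⟨ opt≤costVia c r rs y ⟩
      length (moveTo c y) + serveCost y r + opt y rs
    ≤⟨ +-mono-≤ (+-monoˡ-≤ (serveCost y r) (length-moveTo≤1 c y)) (opt≤staticCost y rs) ⟩
      1 + serveCost y r + staticCost y rs
    ∎
    where
      open ≤-Reasoning
      opt≤staticCost : ∀ y σ → opt y σ ≤ staticCost y σ
      opt≤staticCost y σ = ≤-trans (opt≤offCostFrom y 0 (λ _ → []) σ) (≤-reflexive (offCostFrom-stay y 0 σ))

+-interchange₃ : ∀ a b c d e f → (a + d) + (b + e) + (c + f) ≡ (a + b + c) + (d + e + f)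
+-interchange₃ = solve-∀

3*m≤3+a+b+c : ∀ {m a b c} → m ≤ 1 + a → m ≤ 1 + b → m ≤ 1 + c → 3 * m ≤ 3 + (a + b + c)
3*m≤3+a+b+c {m} {a} {b} {c} m≤1+a m≤1+b m≤1+c = begin
    3 * m                       ≡⟨ 3*m≡m+m+m m ⟩
    m + m + m                   ≤⟨ +-mono-≤ (+-mono-≤ m≤1+a m≤1+b) m≤1+c ⟩
    (1 + a) + (1 + b) + (1 + c) ≡⟨ +-interchange₃ 1 1 1 a b c ⟩
    3 + (a + b + c)             ∎
  where
    open ≤-Reasoning
    3*m≡m+m+m : ∀ m → 3 * m ≡ m + m + m
    3*m≡m+m+m = solve-∀

module _ {k : ℕ} where

  avoiding : Fin (3 + k) → Req (3 + k)
  avoiding Fin.zero             = req (# 1) (# 2) (λ ())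
  avoiding (Fin.suc Fin.zero)   = req (# 0) (# 2) (λ ())
  avoiding (Fin.suc (Fin.suc _)) = req (# 0) (# 1) (λ ())

  serveCost-avoiding : ∀ x → serveCost x (avoiding x) ≡ 2
  serveCost-avoiding Fin.zero                        = refl
  serveCost-avoiding (Fin.suc Fin.zero)              = refl
  serveCost-avoiding (Fin.suc (Fin.suc Fin.zero))    = refl
  serveCost-avoiding (Fin.suc (Fin.suc (Fin.suc _))) = refl

  serveCost-avoiding-sum : ∀ x → serveCost (# 0) (avoiding x) + serveCost (# 1) (avoiding x)
                                   + serveCost (# 2) (avoiding x) ≡ 4
  serveCost-avoiding-sum Fin.zero              = refl
  serveCost-avoiding-sum (Fin.suc Fin.zero)    = refl
  serveCost-avoiding-sum (Fin.suc (Fin.suc _)) = refl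

  2≤migrate+serve-avoiding : ∀ x ms → 2 ≤ length ms + serveCost (applyMigs x ms) (avoiding x)
  2≤migrate+serve-avoiding x []       = ≤-reflexive (sym (serveCost-avoiding x))
  2≤migrate+serve-avoiding x (m ∷ ms) = +-mono-≤ (s≤s (z≤n {length ms})) (serveCost≥1 (applyMigs m ms) (avoiding x))

  adversary : OnlineAlg (3 + k) → ℕ → Fin (3 + k) → List (Req (3 + k)) → List (Req (3 + k))
  adversary A zero    x h = []
  adversary A (suc m) x h = r ∷ adversary A m (applyMigs x (A h r)) (h ++ [ r ])
    where r = avoiding x

  onCostFrom-adversary : ∀ A m x h → 2 * m ≤ onCostFrom x A h (adversary A m x h)
  onCostFrom-adversary A zero    x h = z≤n
  onCostFrom-adversary A (suc m) x h = begin
      2 * suc m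
    ≡⟨ *-suc 2 m ⟩
      2 + 2 * m
    ≤⟨ +-mono-≤ (2≤migrate+serve-avoiding x ms) (onCostFrom-adversary A m (applyMigs x ms) (h ++ [ r ])) ⟩
      onCostFrom x A h (adversary A (suc m) x h)
    ∎
    where
      open ≤-Reasoning
      r  = avoiding x
      ms = A h r

  staticCost-adversary : ∀ A m x h → let σ = adversary A m x h in
    staticCost (# 0) σ + staticCost (# 1) σ + staticCost (# 2) σ ≡ 4 * m
  staticCost-adversary A zero    x h = refl
  staticCost-adversary A (suc m) x h = begin
      (c₀ + staticCost (# 0) σ) + (c₁ + staticCost (# 1) σ) + (c₂ + staticCost (# 2) σ)
    ≡⟨ +-interchange₃ c₀ c₁ c₂ (staticCost (# 0) σ) (staticCost (# 1) σ) (staticCost (# 2) σ) ⟩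
      (c₀ + c₁ + c₂) + (staticCost (# 0) σ + staticCost (# 1) σ + staticCost (# 2) σ)
    ≡⟨ cong₂ _+_ (serveCost-avoiding-sum x) (staticCost-adversary A m x' (h ++ [ r ])) ⟩
      4 + 4 * m
    ≡⟨ sym (*-suc 4 m) ⟩
      4 * suc m
    ∎
    where
      open ≡-Reasoning
      r  = avoiding x
      x' = applyMigs x (A h r)
      σ  = adversary A m x' (h ++ [ r ])
      c₀ = serveCost (# 0) r
      c₁ = serveCost (# 1) r
      c₂ = serveCost (# 2) r

  3*opt-adversary≤ : ∀ c A m x h → 3 * opt c (adversary A m x h) ≤ 3 + 4 * m
  3*opt-adversary≤ c A m x h = begin
      3 * opt c σ
    ≤⟨ 3*m≤3+a+b+c (opt≤1+staticCost c (# 0) σ) (opt≤1+staticCost c (# 1) σ) (opt≤1+staticCost c (# 2) σ) ⟩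
      3 + (staticCost (# 0) σ + staticCost (# 1) σ + staticCost (# 2) σ)
    ≡⟨ cong (3 +_) (staticCost-adversary A m x h) ⟩
      3 + 4 * m
    ∎
    where
      open ≤-Reasoning
      σ = adversary A m x h

ratio<3/2⇒2m≤3p : ∀ {p q m opt alg} → 2 * p < 3 * q → 3 * opt ≤ 3 + 4 * m → 2 * m ≤ alg
                → q * alg ≤ p * opt → 2 * m ≤ 3 * p
ratio<3/2⇒2m≤3p {p} {q} {m} {opt} {alg} 2p<3q 3opt≤3+4m 2m≤alg ratio =
  +-cancelˡ-≤ (p * (4 * m)) (2 * m) (3 * p) (begin
    p * (4 * m) + 2 * m    ≡⟨ left p m ⟩
    suc (2 * p) * (2 * m)  ≤⟨ *-monoˡ-≤ (2 * m) 2p<3q ⟩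
    3 * q * (2 * m)        ≤⟨ *-monoʳ-≤ (3 * q) 2m≤alg ⟩
    3 * q * alg            ≡⟨ *-assoc 3 q alg ⟩
    3 * (q * alg)          ≤⟨ *-monoʳ-≤ 3 ratio ⟩
    3 * (p * opt)          ≡⟨ swap p opt ⟩
    p * (3 * opt)          ≤⟨ *-monoʳ-≤ p 3opt≤3+4m ⟩
    p * (3 + 4 * m)        ≡⟨ right p m ⟩
    p * (4 * m) + 3 * p    ∎)
  where
    open ≤-Reasoning
    left : ∀ p m → p * (4 * m) + 2 * m ≡ suc (2 * p) * (2 * m)
    left = solve-∀
    swap : ∀ p opt → 3 * (p * opt) ≡ p * (3 * opt)
    swap = solve-∀
    right : ∀ p m → p * (3 + 4 * m) ≡ p * (4 * m) + 3 * p
    right = solve-∀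

theorem2 : (n : ℕ) → 3 ≤ n → (c₀ : Fin n) → (A : OnlineAlg n) → (p q : ℕ) → 0 < q
         → 2 * p < 3 * q → ¬ Competitive c₀ A p q
theorem2 _ (s≤s (s≤s (s≤s _))) c₀ A p q _ 2p<3q competitive =
  n≮n (3 * p) (≤-trans (m≤m+n m (m + 0)) 2m≤3p)
  where
    m = suc (3 * p)
    σ = adversary A m c₀ []
    2m≤3p : 2 * m ≤ 3 * p
    2m≤3p = ratio<3/2⇒2m≤3p {p} {q} {m} {opt c₀ σ} {onCost c₀ A σ} 2p<3q
              (3*opt-adversary≤ c₀ A m c₀ [])
              (onCostFrom-adversary A m c₀ [])
              (competitive σ (opt c₀ σ) (isOPT-opt c₀ σ))
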